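{- Let $G$ be a graph. Then $\chi_\rho''(G) \geq \chi_\rho(G)$.
   Context: All graphs are simple, finite and undirected. For a graph $G$, the packing chromatic number $\chi_\rho(G)$ is the smallest integer $k$ for which there is a map $c:V(G)\to\{1,\dots,k\}$ such that any two distinct vertices $u,v$ with $c(u)=c(v)=i$ satisfy $d(u,v)>i$ ($d$ the shortest-path distance). The total graph $T(G)$ has vertex set $V(G)\cup E(G)$, where two elements are adjacent if they are adjacent vertices of $G$, incident edges of $G$ (sharing an endpoint), or a vertex and an edge of $G$ having that vertex as an endpoint. A packing total coloring of $G$ is a map $c:V(G)\cup E(G)\to\{1,2,\dots\}$ such that for any two distinct elements $A,B\in V(G)\cup E(G)$ with $c(A)=c(B)=i$, the distance between $A$ and $B$ in $T(G)$ is greater than $i$. The packing total chromatic number $\chi_\rho''(G)$ is the smallest $k$ such that $G$ has a packing total coloring with colors from $\{1,\dots,k\}$; equivalently $\chi_\rho''(G)=\chi_\rho(T(G))$. -}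

module Defs where

open import Data.Nat using (ℕ; zero; suc; _≤_; _<ᵇ_)
open import Data.Fin using (Fin; toℕ)
open import Data.Bool using (Bool; true; false; T)
open import Data.Product using (Σ; _×_; _,_; proj₁; proj₂)
open import Data.Sum using (_⊎_; inj₁; inj₂)
open import Relation.Binary.PropositionalEquality using (_≡_; _≢_)
open import Relation.Nullary using (¬_)

record Graph : Set where
  field
    n     : ℕ
    adj   : Fin n → Fin n → Bool
    sym   : ∀ u v → adj u v ≡ adj v u
    irrefl : ∀ u → adj u u ≡ false

data Walk {V : Set} (R : V → V → Set) : V → V → ℕ → Set where
  here : ∀ {u} → Walk R u u zero
  step : ∀ {u w v k} → R u w → Walk R w v k → Walk R u v (suc k)

-- d(u,v) > i  (distance infinite if disconnected counts as > i)
DistGt : {V : Set} (R : V → V → Set) → V → V → ℕ → Set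
DistGt R u v i = ∀ k → k ≤ i → ¬ Walk R u v k

IsPackingColoring : {V : Set} (R : V → V → Set) (k : ℕ) (c : V → ℕ) → Set
IsPackingColoring {V} R k c =
  (∀ v → 1 ≤ c v × c v ≤ k) ×
  (∀ u v → u ≢ v → c u ≡ c v → DistGt R u v (c u))

HasPackingColoring : {V : Set} (R : V → V → Set) (k : ℕ) → Set
HasPackingColoring {V} R k = Σ (V → ℕ) (IsPackingColoring R k)

IsPackingChromaticNumber : {V : Set} (R : V → V → Set) (k : ℕ) → Set
IsPackingChromaticNumber R k =
  HasPackingColoring R k × (∀ j → HasPackingColoring R j → k ≤ j)

module _ (G : Graph) where
  open Graph G

  Adj : Fin n → Fin n → Set
  Adj u v = T (adj u v)

  -- An edge {u,v} is represented uniquely by its endpoints with u < v.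
  Edge : Set
  Edge = Σ (Fin n × Fin n) λ p → T (toℕ (proj₁ p) <ᵇ toℕ (proj₂ p)) × T (adj (proj₁ p) (proj₂ p))

  endpt₁ endpt₂ : Edge → Fin n
  endpt₁ e = proj₁ (proj₁ e)
  endpt₂ e = proj₂ (proj₁ e)

  IncidentTo : Fin n → Edge → Set
  IncidentTo v e = (v ≡ endpt₁ e) ⊎ (v ≡ endpt₂ e)

  ShareEndpoint : Edge → Edge → Set
  ShareEndpoint e f = IncidentTo (endpt₁ e) f ⊎ IncidentTo (endpt₂ e) f

  TotalV : Set
  TotalV = Fin n ⊎ Edge

  TotalAdj : TotalV → TotalV → Set
  TotalAdj (inj₁ u) (inj₁ v) = Adj u v
  TotalAdj (inj₁ u) (inj₂ e) = IncidentTo u e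
  TotalAdj (inj₂ e) (inj₁ u) = IncidentTo u e
  TotalAdj (inj₂ e) (inj₂ f) = e ≢ f × ShareEndpoint e f

IsPackingChromaticNum : Graph → ℕ → Set
IsPackingChromaticNum G k = IsPackingChromaticNumber (Adj G) k

IsPackingTotalChromaticNum : Graph → ℕ → Set
IsPackingTotalChromaticNum G k = IsPackingChromaticNumber (TotalAdj G) k

{-# OPTIONS --safe #-}
module Submission where

open import Defs
open import Data.Nat using (ℕ; _≥_)
open import Data.Product using (_,_)
open import Data.Sum.Properties using (inj₁-injective)
open import Data.Sum using (inj₁)
open import Function using (_∘_; id)
open import Relation.Binary.PropositionalEquality using (_≡_)

-- G sits inside T(G) as the vertices of G, so distances in T(G) are at most those
-- in G and a packing colouring of T(G) restricts to one of G.

module _ {V W : Set} {R : V → V → Set} {S : W → W → Set}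
         (f : V → W) (f-hom : ∀ {u v} → R u v → S (f u) (f v)) where

  map-Walk : ∀ {u v k} → Walk R u v k → Walk S (f u) (f v) k
  map-Walk here       = here
  map-Walk (step r w) = step (f-hom r) (map-Walk w)

  DistGt-comap : ∀ {u v i} → DistGt S (f u) (f v) i → DistGt R u v i
  DistGt-comap far k k≤i = far k k≤i ∘ map-Walk

  module _ (f-injective : ∀ {u v} → f u ≡ f v → u ≡ v) where

    isPackingColoring-comap : ∀ {k c} → IsPackingColoring S k c → IsPackingColoring R k (c ∘ f)
    isPackingColoring-comap (inRange , packed) =
      inRange ∘ f ,
      λ u v u≢v same → DistGt-comap (packed (f u) (f v) (u≢v ∘ f-injective) same)

    hasPackingColoring-comap : ∀ {k} → HasPackingColoring S k → HasPackingColoring R k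
    hasPackingColoring-comap (c , isColoring) = c ∘ f , isPackingColoring-comap isColoring

    packingChromaticNumber-mono : ∀ {a b} →
      IsPackingChromaticNumber S a → IsPackingChromaticNumber R b → a ≥ b
    packingChromaticNumber-mono (coloringS , _) (_ , minimalR) =
      minimalR _ (hasPackingColoring-comap coloringS)

proposition2p1 : (G : Graph) (a b : ℕ) →
    IsPackingTotalChromaticNum G a → IsPackingChromaticNum G b → a ≥ b
proposition2p1 G a b =
  packingChromaticNumber-mono {R = Adj G} {S = TotalAdj G} inj₁ id inj₁-injective
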